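{- For integers $n\ge 0$ and $k\ge 0$, let $J^A_{k,n}$ denote the number of maximal configurations resistant to altruists of length $n$ with exactly $k$ occupied lots (with $J^A_{0,0}=1$, counting the empty configuration). Then, as formal power series, $$\sum_{n\ge0}\sum_{k\ge0} J^A_{k,n}\,x^k y^n=\frac{1+xy+x^2y^2+x^2y^3+x^3y^4}{1-x^2y^3-x^2y^4-x^3y^5}=\frac{1+xy+x^2y^2+x^2y^3+x^3y^4}{(1-xy^2-x^2y^3)(1+xy^2)}.$$
   Context: A configuration of length $n$ is a string $c_1\cdots c_n\in\{0,1\}^n$; $c_p=1$ means lot $p$ is occupied by a house. A house at position $p$ is blocked if $1<p<n$ and $c_{p-1}=c_{p+1}=1$. A configuration is permissible if no house is blocked; it is maximal if it is permissible and changing any single $0$ to $1$ makes it non-permissible. A maximal configuration is resistant to altruists if for every empty lot $p$, after setting $c_p=1$ the resulting configuration contains a blocked house at some position other than $p$. -}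

module Defs where

open import Data.Bool using (Bool; true; false)
open import Data.Nat as ℕ using (ℕ; zero; suc; _∸_)
open import Data.Fin using (Fin; toℕ)
open import Data.Fin.Properties using (any?; all?)
open import Data.Vec using (Vec; []; _∷_; lookup; _[_]≔_; count)
open import Data.List as List using (List; []; _∷_; _++_; map; length; filter)
open import Data.Integer as ℤ using (ℤ; +_; -_)
open import Data.Product using (Σ; ∃; _×_; _,_)
open import Relation.Nullary using (¬_; Dec; yes; no)
open import Relation.Nullary.Decidable using (_×-dec_; ¬?; _→-dec_)
open import Relation.Binary.PropositionalEquality using (_≡_; _≢_)
open import Data.Bool.Properties using () renaming (_≟_ to _≟ᵇ_)
open import Data.Fin.Properties using () renaming (_≟_ to _≟ᶠ_)
open import Data.Nat.Properties using () renaming (_≟_ to _≟ⁿ_)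

-- A configuration of length n: c_p = true means lot p is occupied.
-- Lots are indexed 0 .. n-1 (Fin n) instead of 1 .. n.
Config : ℕ → Set
Config n = Vec Bool n

Blocked : ∀ {n} → Config n → Fin n → Set
Blocked {n} c p =
  lookup c p ≡ true ×
  Σ (Fin n) λ i → Σ (Fin n) λ j →
    (suc (toℕ i) ≡ toℕ p) × (suc (toℕ p) ≡ toℕ j) ×
    (lookup c i ≡ true) × (lookup c j ≡ true)

Permissible : ∀ {n} → Config n → Set
Permissible {n} c = (p : Fin n) → ¬ Blocked c p

Maximal : ∀ {n} → Config n → Set
Maximal {n} c = Permissible c ×
  ((p : Fin n) → lookup c p ≡ false → ¬ Permissible (c [ p ]≔ true))

ResistantToAltruists : ∀ {n} → Config n → Set
ResistantToAltruists {n} c = Maximal c ×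
  ((p : Fin n) → lookup c p ≡ false →
     Σ (Fin n) λ q → (q ≢ p) × Blocked (c [ p ]≔ true) q)

blocked? : ∀ {n} (c : Config n) (p : Fin n) → Dec (Blocked c p)
blocked? {n} c p = (lookup c p ≟ᵇ true) ×-dec
  any? (λ i → any? (λ j →
    (suc (toℕ i) ≟ⁿ toℕ p) ×-dec (suc (toℕ p) ≟ⁿ toℕ j) ×-dec
    (lookup c i ≟ᵇ true) ×-dec (lookup c j ≟ᵇ true)))

permissible? : ∀ {n} (c : Config n) → Dec (Permissible c)
permissible? c = all? (λ p → ¬? (blocked? c p))

maximal? : ∀ {n} (c : Config n) → Dec (Maximal c)
maximal? c = permissible? c ×-dec
  all? (λ p → (lookup c p ≟ᵇ false) →-dec ¬? (permissible? (c [ p ]≔ true)))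

resistant? : ∀ {n} (c : Config n) → Dec (ResistantToAltruists c)
resistant? c = maximal? c ×-dec
  all? (λ p → (lookup c p ≟ᵇ false) →-dec
    any? (λ q → ¬? (q ≟ᶠ p) ×-dec blocked? (c [ p ]≔ true) q))

allConfigs : (n : ℕ) → List (Config n)
allConfigs zero = [] ∷ []
allConfigs (suc n) = map (false ∷_) (allConfigs n) ++ map (true ∷_) (allConfigs n)

occupied : ∀ {n} → Config n → ℕ
occupied = count (λ b → b ≟ᵇ true)

JA : ℕ → ℕ → ℕ
JA k n = length (filter (λ c → resistant? c ×-dec (occupied c ≟ⁿ k)) (allConfigs n))

-- Formal power series in x, y with integer coefficients:
-- F k n is the coefficient of x^k y^n.

FPS : Set
FPS = ℕ → ℕ → ℤ

_≐_ : FPS → FPS → Set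
F ≐ G = ∀ k n → F k n ≡ G k n

sumTo : ℕ → (ℕ → ℤ) → ℤ
sumTo zero f = f 0
sumTo (suc m) f = sumTo m f ℤ.+ f (suc m)

_⊛_ : FPS → FPS → FPS
(F ⊛ G) k n = sumTo k λ a → sumTo n λ b → F a b ℤ.* G (k ∸ a) (n ∸ b)

-- polynomial given as a list of terms (coefficient, exponent of x, exponent of y)
poly : List (ℤ × ℕ × ℕ) → FPS
poly [] k n = + 0
poly ((c , a , b) ∷ ts) k n with a ≟ⁿ k | b ≟ⁿ n
... | yes _ | yes _ = c ℤ.+ poly ts k n
... | _     | _     = poly ts k n

JAseries : FPS
JAseries k n = + JA k n

numerator : FPS
numerator = poly ((+ 1 , 0 , 0) ∷ (+ 1 , 1 , 1) ∷ (+ 1 , 2 , 2) ∷ (+ 1 , 2 , 3) ∷ (+ 1 , 3 , 4) ∷ [])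

denominator : FPS
denominator = poly ((+ 1 , 0 , 0) ∷ (- + 1 , 2 , 3) ∷ (- + 1 , 2 , 4) ∷ (- + 1 , 3 , 5) ∷ [])

factor₁ : FPS
factor₁ = poly ((+ 1 , 0 , 0) ∷ (- + 1 , 1 , 2) ∷ (- + 1 , 2 , 3) ∷ [])

factor₂ : FPS
factor₂ = poly ((+ 1 , 0 , 0) ∷ (+ 1 , 1 , 2) ∷ [])

-- A configuration is resistant to altruists exactly when every lot passes a test on the five lots
-- around it, lots off the street counting as empty: a house must not be blocked, and an empty lot
-- must be preceded or followed by two houses, because a house placed there blocks a house other
-- than itself exactly when it lands next to two houses in a row. An automaton whose state is four
-- consecutive lots accepts exactly these configurations. Hence column n + 1 (the coefficient of
-- y ^ (n + 1)) of the counting series from any state is the sum of column n of the series from two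
-- successor states, one of them multiplied by x, so if the denominator annihilates column n of every
-- state's series, it annihilates column n + 1 as well. Evaluation establishes this for n = 5 and
-- computes the columns n ≤ 6 of the product, which agree with the numerator.
module Submission where

open import Defs
open import Data.Product using (_×_)

open import Data.Bool using (Bool; true; false; not; _∧_; _∨_; if_then_else_)
open import Data.Bool.Properties using (∧-conicalˡ; ∧-conicalʳ; ∧-comm; ∧-zeroʳ; ∨-zeroʳ)
open import Data.Empty using (⊥; ⊥-elim)
open import Data.Fin using (Fin; zero; suc; toℕ)
open import Data.Fin.Properties using (toℕ-injective; ∀-cons)
open import Data.Integer as ℤ using (ℤ; +_; -_; _+_; _*_)
open import Data.Integer.Properties using (*-zeroʳ; +-identityʳ; +-identityˡ; *-distribˡ-+)
open import Data.Integer.Tactic.RingSolver using (solve-∀)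
open import Data.List using (List; []; _∷_; map; length; filter; filterᵇ; upTo) renaming (_++_ to _++ᴸ_)
open import Data.List.Properties using (filter-++; length-++)
open import Data.List.Membership.Propositional using (_∈_)
open import Data.List.Membership.Propositional.Properties using (∈-map⁺; ∈-++⁺ˡ; ∈-++⁺ʳ; ∈-upTo⁺)
open import Data.List.Relation.Unary.All as All using (All; []; _∷_; all?)
open import Data.List.Relation.Unary.Any using (here)
open import Data.Nat as ℕ using (ℕ; zero; suc; _∸_; _≡ᵇ_; _≤_; _<_; _≤?_; z≤n; s≤s)
open import Data.Nat.Properties
  using (≤-refl; ≤-trans; ≤-<-trans; ≤-pred; m≤n⇒m≤1+n; m≤m+n; <⇒≢; ≤∧≢⇒<; ≰⇒>; ≮⇒≥;
         m∸n≤m; m∸[m∸n]≡n; m+[n∸m]≡n; 1+n≢n; m≢1+n+m; suc-injective)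
open import Data.Product using (_,_; ∃-syntax)
open import Data.Sum using (_⊎_; inj₁; inj₂)
open import Data.Vec using (Vec; []; _∷_; lookup; _[_]≔_; _++_)
open import Function using (_∘_; _$_)
open import Function.Bundles using (_⇔_; mk⇔; Equivalence)
open import Level using (0ℓ)
open import Relation.Binary.PropositionalEquality
open import Relation.Nullary using (¬_; Dec; does; yes; no; contradiction)
open import Relation.Nullary.Decidable using (T?; from-yes; dec-true; dec-false)
open import Relation.Unary using (Pred; Decidable)

open ≡-Reasoning

private
  variable
    i j k n : ℕ
    f g : ℕ → ℤ
    F G H : FPS

does-≡ : ∀ {A : Set} (a? : Dec A) b → (A → b ≡ true) → (b ≡ true → A) → does a? ≡ b
does-≡ a? true  _   b⇒A = dec-true a? (b⇒A refl)
does-≡ a? false A⇒b _   = dec-false a? (λ a → contradiction (A⇒b a) λ ())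

∧-intro : ∀ {x y} → x ≡ true → y ≡ true → x ∧ y ≡ true
∧-intro refl refl = refl

filter-cong : ∀ {A : Set} {P Q : Pred A 0ℓ} (P? : Decidable P) (Q? : Decidable Q) →
              (∀ x → does (P? x) ≡ does (Q? x)) → ∀ xs → filter P? xs ≡ filter Q? xs
filter-cong P? Q? P≡Q []       = refl
filter-cong P? Q? P≡Q (x ∷ xs) with does (P? x) | does (Q? x) | P≡Q x
... | true  | .true  | refl = cong (x ∷_) (filter-cong P? Q? P≡Q xs)
... | false | .false | refl = filter-cong P? Q? P≡Q xs

length-filter-map : ∀ {A B : Set} {P : Pred B 0ℓ} (P? : Decidable P) (h : A → B) xs →
                    length (filter P? (map h xs)) ≡ length (filter (P? ∘ h) xs)
length-filter-map P? h []       = refl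
length-filter-map P? h (x ∷ xs) with does (P? (h x))
... | true  = cong suc (length-filter-map P? h xs)
... | false = length-filter-map P? h xs

filterᵇ-none : ∀ {A : Set} (p : A → Bool) → (∀ x → p x ≡ false) → ∀ xs → filterᵇ p xs ≡ []
filterᵇ-none p none []       = refl
filterᵇ-none p none (x ∷ xs) rewrite none x = filterᵇ-none p none xs

ℕ-split : ∀ {P : ℕ → Set} m → (∀ k → k < m → P k) → (∀ k → P (m ℕ.+ k)) → ∀ k → P k
ℕ-split {P} m below above k with k ℕ.<? m
... | yes k<m = below k k<m
... | no  k≮m = subst P (m+[n∸m]≡n (≮⇒≥ k≮m)) (above (k ∸ m))

-- Formal power series

infixl 6 _⊕_
_⊕_ : FPS → FPS → FPS
(F ⊕ G) k n = F k n + G k n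

zeroSeries : FPS
zeroSeries _ _ = + 0

-- x ^ i * y ^ j * F
shift : ℕ → ℕ → FPS → FPS
shift (suc i) j       F zero    n       = + 0
shift (suc i) j       F (suc k) n       = shift i j F k n
shift zero    zero    F k       n       = F k n
shift zero    (suc j) F k       zero    = + 0
shift zero    (suc j) F k       (suc n) = shift zero j F k n

dropColumn : FPS → FPS
dropColumn F k n = F k (suc n)

shift-apply : ∀ i j F → i ≤ k → j ≤ n → shift i j F k n ≡ F (k ∸ i) (n ∸ j)
shift-apply (suc i) j       F (s≤s i≤k) j≤n       = shift-apply i j F i≤k j≤n
shift-apply zero    zero    F z≤n       z≤n       = refl
shift-apply zero    (suc j) F z≤n       (s≤s j≤n) = shift-apply zero j F z≤n j≤n

shift-vanishesˣ : ∀ i j F → k < i → shift i j F k n ≡ + 0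
shift-vanishesˣ {k = zero}  (suc i) j F _         = refl
shift-vanishesˣ {k = suc k} (suc i) j F (s≤s k<i) = shift-vanishesˣ i j F k<i

shift-vanishesʸ : ∀ i j F → n < j → shift i j F k n ≡ + 0
shift-vanishesʸ {k = zero}  (suc i) j       F n<j       = refl
shift-vanishesʸ {k = suc k} (suc i) j       F n<j       = shift-vanishesʸ i j F n<j
shift-vanishesʸ {n = zero}  zero    (suc j) F _         = refl
shift-vanishesʸ {n = suc n} zero    (suc j) F (s≤s n<j) = shift-vanishesʸ zero j F n<j

shift-cong : ∀ i j → F ≐ G → shift i j F ≐ shift i j G
shift-cong (suc i) j       F≐G zero    n       = refl
shift-cong (suc i) j       F≐G (suc k) n       = shift-cong i j F≐G k n
shift-cong zero    zero    F≐G k       n       = F≐G k n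
shift-cong zero    (suc j) F≐G k       zero    = refl
shift-cong zero    (suc j) F≐G k       (suc n) = shift-cong zero j F≐G k n

shift-zero : ∀ i j → shift i j zeroSeries ≐ zeroSeries
shift-zero (suc i) j       zero    n       = refl
shift-zero (suc i) j       (suc k) n       = shift-zero i j k n
shift-zero zero    zero    k       n       = refl
shift-zero zero    (suc j) k       zero    = refl
shift-zero zero    (suc j) k       (suc n) = shift-zero zero j k n

shift-⊕ : ∀ i j F G → shift i j (F ⊕ G) ≐ (shift i j F ⊕ shift i j G)
shift-⊕ (suc i) j       F G zero    n       = refl
shift-⊕ (suc i) j       F G (suc k) n       = shift-⊕ i j F G k n
shift-⊕ zero    zero    F G k       n       = refl
shift-⊕ zero    (suc j) F G k       zero    = refl
shift-⊕ zero    (suc j) F G k       (suc n) = shift-⊕ zero j F G k n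

shift-shiftˣ : ∀ i j F → shift i j (shift 1 0 F) ≐ shift (suc i) j F
shift-shiftˣ (suc i) j       F zero    n       = refl
shift-shiftˣ (suc i) j       F (suc k) n       = shift-shiftˣ i j F k n
shift-shiftˣ zero    zero    F k       n       = refl
shift-shiftˣ zero    (suc j) F zero    zero    = refl
shift-shiftˣ zero    (suc j) F (suc k) zero    = refl
shift-shiftˣ zero    (suc j) F zero    (suc n) = shift-shiftˣ zero j F zero n
shift-shiftˣ zero    (suc j) F (suc k) (suc n) = shift-shiftˣ zero j F (suc k) n

shift-dropColumn : ∀ i j F → j ≤ n → shift i j F k (suc n) ≡ shift i j (dropColumn F) k n
shift-dropColumn {k = zero}  (suc i) j       F j≤n       = refl
shift-dropColumn {k = suc k} (suc i) j       F j≤n       = shift-dropColumn i j F j≤n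
shift-dropColumn             zero    zero    F j≤n       = refl
shift-dropColumn             zero    (suc j) F (s≤s j≤n) = shift-dropColumn zero j F j≤n

sumTo-cong : ∀ m → (∀ a → a ≤ m → f a ≡ g a) → sumTo m f ≡ sumTo m g
sumTo-cong zero    f≗g = f≗g 0 z≤n
sumTo-cong (suc m) f≗g =
  cong₂ _+_ (sumTo-cong m (λ a a≤m → f≗g a (m≤n⇒m≤1+n a≤m))) (f≗g (suc m) ≤-refl)

sumTo-zero : ∀ m → (∀ a → a ≤ m → f a ≡ + 0) → sumTo m f ≡ + 0
sumTo-zero zero    f≗0 = f≗0 0 z≤n
sumTo-zero (suc m) f≗0 =
  cong₂ _+_ (sumTo-zero m (λ a a≤m → f≗0 a (m≤n⇒m≤1+n a≤m))) (f≗0 (suc m) ≤-refl)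

sumTo-+ : ∀ m f g → sumTo m (λ a → f a + g a) ≡ sumTo m f + sumTo m g
sumTo-+ zero    f g = refl
sumTo-+ (suc m) f g = begin
  sumTo m (λ a → f a + g a) + (f (suc m) + g (suc m))  ≡⟨ cong (_+ (f (suc m) + g (suc m))) (sumTo-+ m f g) ⟩
  sumTo m f + sumTo m g + (f (suc m) + g (suc m))      ≡⟨ interchange (sumTo m f) _ _ _ ⟩
  sumTo m f + f (suc m) + (sumTo m g + g (suc m))      ∎
  where
  interchange : ∀ a b c d → a + b + (c + d) ≡ a + c + (b + d)
  interchange = solve-∀

sumTo-single : ∀ m {a₀} → a₀ ≤ m → (∀ a → a ≤ m → a ≢ a₀ → f a ≡ + 0) → sumTo m f ≡ f a₀
sumTo-single zero    z≤n  _   = refl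
sumTo-single {f = f} (suc m) {a₀} a₀≤1+m f≗0 with a₀ ℕ.≟ suc m
... | yes refl = begin
  sumTo m f + f (suc m)  ≡⟨ cong (_+ f (suc m)) (sumTo-zero m (λ a a≤m →
                               f≗0 a (m≤n⇒m≤1+n a≤m) (<⇒≢ (s≤s a≤m)))) ⟩
  + 0 + f (suc m)        ≡⟨ +-identityˡ _ ⟩
  f (suc m)              ∎
... | no a₀≢1+m = begin
  sumTo m f + f (suc m)  ≡⟨ cong₂ _+_ (sumTo-single m a₀≤m (λ a a≤m → f≗0 a (m≤n⇒m≤1+n a≤m)))
                                     (f≗0 (suc m) ≤-refl (≢-sym a₀≢1+m)) ⟩
  f a₀ + + 0             ≡⟨ +-identityʳ _ ⟩
  f a₀                   ∎
  where a₀≤m = ≤-pred (≤∧≢⇒< a₀≤1+m a₀≢1+m)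

sumTo-∸-single : ∀ m (g : ℕ → ℕ → ℤ) → i ≤ m → (∀ a l → l ≢ i → g a l ≡ + 0) →
                 sumTo m (λ a → g a (m ∸ a)) ≡ g (m ∸ i) i
sumTo-∸-single {i} m g i≤m g≗0 = begin
  sumTo m (λ a → g a (m ∸ a))  ≡⟨ sumTo-single m (m∸n≤m m i) (λ a a≤m a≢m∸i →
                                    g≗0 a (m ∸ a) (a≢m∸i ∘ trans (sym (m∸[m∸n]≡n a≤m)) ∘ cong (m ∸_)))
                                 ⟩
  g (m ∸ i) (m ∸ (m ∸ i))      ≡⟨ cong (g (m ∸ i)) (m∸[m∸n]≡n i≤m) ⟩
  g (m ∸ i) i                  ∎

sumTo-∸-zero : ∀ m (g : ℕ → ℕ → ℤ) → m < i → (∀ a l → l ≢ i → g a l ≡ + 0) →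
               sumTo m (λ a → g a (m ∸ a)) ≡ + 0
sumTo-∸-zero m g m<i g≗0 = sumTo-zero m (λ a _ → g≗0 a (m ∸ a) (<⇒≢ (≤-<-trans (m∸n≤m m a) m<i)))

monomial : ℤ → ℕ → ℕ → FPS
monomial c i j k n with i ℕ.≟ k | j ℕ.≟ n
... | yes _ | yes _ = c
... | _     | _     = + 0

monomial-offˣ : ∀ c → i ≢ k → monomial c i j k n ≡ + 0
monomial-offˣ {i = i} {k = k} {j = j} {n = n} c i≢k with i ℕ.≟ k | j ℕ.≟ n
... | yes i≡k | _ = contradiction i≡k i≢k
... | no _    | _ = refl

monomial-offʸ : ∀ c → j ≢ n → monomial c i j k n ≡ + 0
monomial-offʸ {j = j} {n = n} {i = i} {k = k} c j≢n with i ℕ.≟ k | j ℕ.≟ n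
... | yes _ | yes j≡n = contradiction j≡n j≢n
... | yes _ | no _    = refl
... | no _  | _       = refl

monomial-on : ∀ c i j → monomial c i j i j ≡ c
monomial-on c i j with i ℕ.≟ i | j ℕ.≟ j
... | yes _  | yes _  = refl
... | yes _  | no j≢j = contradiction refl j≢j
... | no i≢i | _      = contradiction refl i≢i

poly-∷ : ∀ c i j ts → poly ((c , i , j) ∷ ts) ≐ (monomial c i j ⊕ poly ts)
poly-∷ c i j ts k n with i ℕ.≟ k | j ℕ.≟ n
... | yes _ | yes _ = refl
... | yes _ | no _  = sym (+-identityˡ _)
... | no _  | _     = sym (+-identityˡ _)

⊛-congʳ : ∀ F → G ≐ H → (F ⊛ G) ≐ (F ⊛ H)
⊛-congʳ F G≐H k n = sumTo-cong k (λ a _ → sumTo-cong n (λ b _ → cong (F a b *_) (G≐H (k ∸ a) (n ∸ b))))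

⊛-⊕ʳ : ∀ F G H → (F ⊛ (G ⊕ H)) ≐ ((F ⊛ G) ⊕ (F ⊛ H))
⊛-⊕ʳ F G H k n = trans
  (sumTo-cong k (λ a _ → trans (sumTo-cong n (λ b _ → *-distribˡ-+ (F a b) _ _)) (sumTo-+ n _ _)))
  (sumTo-+ k _ _)

⊛-monomial : ∀ F c i j → (F ⊛ monomial c i j) ≐ λ k n → shift i j F k n * c
⊛-monomial F c i j k n = by-cases (i ≤? k) (j ≤? n)
  where
  column : ℕ → ℕ → ℤ
  column a l = sumTo n (λ b → F a b * monomial c i j l (n ∸ b))

  column-off : ∀ a l → l ≢ i → column a l ≡ + 0
  column-off a l l≢i = sumTo-zero n (λ b _ →
    trans (cong (F a b *_) (monomial-offˣ c (≢-sym l≢i))) (*-zeroʳ (F a b)))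

  entry : ℕ → ℕ → ℤ
  entry b l = F (k ∸ i) b * monomial c i j i l

  entry-off : ∀ b l → l ≢ j → entry b l ≡ + 0
  entry-off b l l≢j = trans (cong (F (k ∸ i) b *_) (monomial-offʸ c (≢-sym l≢j))) (*-zeroʳ (F (k ∸ i) b))

  by-cases : Dec (i ≤ k) → Dec (j ≤ n) → (F ⊛ monomial c i j) k n ≡ shift i j F k n * c
  by-cases (no i≰k) _ = begin
    (F ⊛ monomial c i j) k n  ≡⟨ sumTo-∸-zero k column (≰⇒> i≰k) column-off ⟩
    + 0                        ≡⟨ cong (_* c) (shift-vanishesˣ i j F (≰⇒> i≰k)) ⟨
    shift i j F k n * c        ∎
  by-cases (yes i≤k) (no j≰n) = begin
    (F ⊛ monomial c i j) k n  ≡⟨ sumTo-∸-single k column i≤k column-off ⟩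
    column (k ∸ i) i           ≡⟨ sumTo-∸-zero n entry (≰⇒> j≰n) entry-off ⟩
    + 0                        ≡⟨ cong (_* c) (shift-vanishesʸ i j F (≰⇒> j≰n)) ⟨
    shift i j F k n * c        ∎
  by-cases (yes i≤k) (yes j≤n) = begin
    (F ⊛ monomial c i j) k n                ≡⟨ sumTo-∸-single k column i≤k column-off ⟩
    column (k ∸ i) i                         ≡⟨ sumTo-∸-single n entry j≤n entry-off ⟩
    F (k ∸ i) (n ∸ j) * monomial c i j i j  ≡⟨ cong (F (k ∸ i) (n ∸ j) *_) (monomial-on c i j) ⟩
    F (k ∸ i) (n ∸ j) * c                   ≡⟨ cong (_* c) (shift-apply i j F i≤k j≤n) ⟨
    shift i j F k n * c                      ∎

Terms : Set
Terms = List (ℤ × ℕ × ℕ)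

yExponent : ℤ × ℕ × ℕ → ℕ
yExponent (_ , _ , j) = j

shiftCombination : Terms → FPS → FPS
shiftCombination []                 F k n = + 0
shiftCombination ((c , i , j) ∷ ts) F k n = shift i j F k n * c + shiftCombination ts F k n

⊛-poly : ∀ F ts → (F ⊛ poly ts) ≐ shiftCombination ts F
⊛-poly F [] k n = sumTo-zero k (λ a _ → sumTo-zero n (λ b _ → *-zeroʳ (F a b)))
⊛-poly F ((c , i , j) ∷ ts) k n = begin
  (F ⊛ poly ((c , i , j) ∷ ts)) k n              ≡⟨ ⊛-congʳ F (poly-∷ c i j ts) k n ⟩
  (F ⊛ (monomial c i j ⊕ poly ts)) k n           ≡⟨ ⊛-⊕ʳ F (monomial c i j) (poly ts) k n ⟩
  (F ⊛ monomial c i j) k n + (F ⊛ poly ts) k n  ≡⟨ cong₂ _+_ (⊛-monomial F c i j k n) (⊛-poly F ts k n) ⟩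
  shiftCombination ((c , i , j) ∷ ts) F k n      ∎

shiftCombination-cong : ∀ ts → F ≐ G → shiftCombination ts F ≐ shiftCombination ts G
shiftCombination-cong []                 F≐G k n = refl
shiftCombination-cong ((c , i , j) ∷ ts) F≐G k n =
  cong₂ _+_ (cong (_* c) (shift-cong i j F≐G k n)) (shiftCombination-cong ts F≐G k n)

shiftCombination-zero : ∀ ts → shiftCombination ts zeroSeries ≐ zeroSeries
shiftCombination-zero []                 k n = refl
shiftCombination-zero ((c , i , j) ∷ ts) k n =
  cong₂ _+_ (cong (_* c) (shift-zero i j k n)) (shiftCombination-zero ts k n)

shiftCombination-⊕ : ∀ ts F G → shiftCombination ts (F ⊕ G) ≐ (shiftCombination ts F ⊕ shiftCombination ts G)
shiftCombination-⊕ []                 F G k n = refl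
shiftCombination-⊕ ((c , i , j) ∷ ts) F G k n = trans
  (cong₂ (λ s r → s * c + r) (shift-⊕ i j F G k n) (shiftCombination-⊕ ts F G k n))
  (distribute (shift i j F k n) (shift i j G k n) c _ _)
  where
  distribute : ∀ x y c u v → (x + y) * c + (u + v) ≡ x * c + u + (y * c + v)
  distribute = solve-∀

shiftCombination-shiftˣ : ∀ ts F → shiftCombination ts (shift 1 0 F) ≐ shift 1 0 (shiftCombination ts F)
shiftCombination-shiftˣ []                 F zero    n = refl
shiftCombination-shiftˣ []                 F (suc k) n = refl
shiftCombination-shiftˣ ((c , i , j) ∷ ts) F zero    n =
  cong₂ _+_ (cong (_* c) (shift-shiftˣ i j F zero n)) (shiftCombination-shiftˣ ts F zero n)
shiftCombination-shiftˣ ((c , i , j) ∷ ts) F (suc k) n =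
  cong₂ _+_ (cong (_* c) (shift-shiftˣ i j F (suc k) n)) (shiftCombination-shiftˣ ts F (suc k) n)

shiftCombination-dropColumn : ∀ ts F → All (λ t → yExponent t ≤ n) ts →
  ∀ k → shiftCombination ts F k (suc n) ≡ shiftCombination ts (dropColumn F) k n
shiftCombination-dropColumn []                 F []           k = refl
shiftCombination-dropColumn ((c , i , j) ∷ ts) F (j≤n ∷ ts≤n) k =
  cong₂ _+_ (cong (_* c) (shift-dropColumn i j F j≤n)) (shiftCombination-dropColumn ts F ts≤n k)

module Annihilation (ts : Terms) where

  record AnnihilatesColumn (F : FPS) (n : ℕ) : Set where
    constructor annihilates
    field vanishes : ∀ k → shiftCombination ts F k n ≡ + 0

  annihilates-cong : F ≐ G → AnnihilatesColumn F n → AnnihilatesColumn G n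
  annihilates-cong {n = n} F≐G (annihilates F↯) =
    annihilates λ k → trans (sym (shiftCombination-cong ts F≐G k n)) (F↯ k)

  annihilates-zero : AnnihilatesColumn zeroSeries n
  annihilates-zero {n = n} = annihilates λ k → shiftCombination-zero ts k n

  annihilates-⊕ : AnnihilatesColumn F n → AnnihilatesColumn G n → AnnihilatesColumn (F ⊕ G) n
  annihilates-⊕ {F = F} {n = n} {G = G} (annihilates F↯) (annihilates G↯) =
    annihilates λ k → trans (shiftCombination-⊕ ts F G k n) (cong₂ _+_ (F↯ k) (G↯ k))

  annihilates-shiftˣ : AnnihilatesColumn F n → AnnihilatesColumn (shift 1 0 F) n
  annihilates-shiftˣ {F = F} {n = n} (annihilates F↯) = annihilates λ where
    zero    → shiftCombination-shiftˣ ts F zero n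
    (suc k) → trans (shiftCombination-shiftˣ ts F (suc k) n) (F↯ k)

  annihilates-dropColumn : All (λ t → yExponent t ≤ n) ts →
    AnnihilatesColumn (dropColumn F) n → AnnihilatesColumn F (suc n)
  annihilates-dropColumn {F = F} ts≤n (annihilates F↯) =
    annihilates λ k → trans (shiftCombination-dropColumn ts F ts≤n k) (F↯ k)

-- Resistance as a condition on windows of five lots

at : Vec Bool n → ℕ → Bool
at []      _       = false
at (x ∷ v) zero    = x
at (x ∷ v) (suc m) = at v m

lookup≡at : (v : Vec Bool n) (p : Fin n) → lookup v p ≡ at v (toℕ p)
lookup≡at (x ∷ v) zero    = refl
lookup≡at (x ∷ v) (suc p) = lookup≡at v p

at-lookup : (v : Vec Bool n) (m : ℕ) → at v m ≡ true → ∃[ p ] toℕ p ≡ m × lookup v p ≡ true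
at-lookup (x ∷ v) zero    vₘ = zero , refl , vₘ
at-lookup (x ∷ v) (suc m) vₘ with at-lookup v m vₘ
... | p , refl , vₚ = suc p , refl , vₚ

at-updateAt-≢ : (v : Vec Bool n) (p : Fin n) {b : Bool} (m : ℕ) → m ≢ toℕ p → at (v [ p ]≔ b) m ≡ at v m
at-updateAt-≢ (x ∷ v) zero    zero    m≢p = ⊥-elim (m≢p refl)
at-updateAt-≢ (x ∷ v) zero    (suc m) m≢p = refl
at-updateAt-≢ (x ∷ v) (suc p) zero    m≢p = refl
at-updateAt-≢ (x ∷ v) (suc p) (suc m) m≢p = at-updateAt-≢ v p m (m≢p ∘ cong suc)

at-updateAt-true : (v : Vec Bool n) (p : Fin n) (m : ℕ) → m ≢ toℕ p →
                   at (v [ p ]≔ true) m ≡ true → at v m ≡ true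
at-updateAt-true v p m m≢p = trans (sym (at-updateAt-≢ v p m m≢p))

ThreeHouses : Vec Bool n → ℕ → Set
ThreeHouses v m = at v m ≡ true × at v (suc m) ≡ true × at v (suc (suc m)) ≡ true

-- Padding with two empty lots puts lot p of c at index p + 2, so that every lot has two neighbours
-- on each side.
blocked⇒threeHouses : (c : Config n) (q : Fin n) → Blocked c q → ThreeHouses (false ∷ false ∷ c) (suc (toℕ q))
blocked⇒threeHouses c q (c[q] , i , j , i+1≡q , q+1≡j , c[i] , c[j]) =
  subst (λ m → at (false ∷ c) m ≡ true) i+1≡q (trans (sym (lookup≡at c i)) c[i]) ,
  trans (sym (lookup≡at c q)) c[q] ,
  subst (λ m → at c m ≡ true) (sym q+1≡j) (trans (sym (lookup≡at c j)) c[j])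

threeHouses⇒blocked : (c : Config n) (q : Fin n) → ThreeHouses (false ∷ false ∷ c) (suc (toℕ q)) → Blocked c q
threeHouses⇒blocked c q (left , centre , right)
  with at-lookup (false ∷ c) (toℕ q) left | at-lookup c (suc (toℕ q)) right
... | suc i , i+1≡q , c[i] | j , j≡q+1 , c[j] =
  trans (lookup≡at c q) centre , i , j , i+1≡q , sym j≡q+1 , c[i] , c[j]

threeHouses-updateAt : (v : Vec Bool n) (p : Fin n) (m : ℕ) → ThreeHouses (v [ p ]≔ true) m →
    ThreeHouses v m
  ⊎ toℕ p ≡ m × at v (suc m) ≡ true × at v (suc (suc m)) ≡ true
  ⊎ toℕ p ≡ suc m
  ⊎ toℕ p ≡ suc (suc m) × at v m ≡ true × at v (suc m) ≡ true
threeHouses-updateAt v p m (v′₀ , v′₁ , v′₂)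
  with toℕ p ℕ.≟ m | toℕ p ℕ.≟ suc m | toℕ p ℕ.≟ suc (suc m)
... | yes p≡m | _ | _ = inj₂ (inj₁ (p≡m ,
  at-updateAt-true v p (suc m) (λ e → 1+n≢n (trans e p≡m)) v′₁ ,
  at-updateAt-true v p (suc (suc m)) (λ e → m≢1+n+m m (sym (trans e p≡m))) v′₂))
... | no _ | yes p≡m+1 | _ = inj₂ (inj₂ (inj₁ p≡m+1))
... | no _ | no _ | yes p≡m+2 = inj₂ (inj₂ (inj₂ (p≡m+2 ,
  at-updateAt-true v p m (λ e → m≢1+n+m m (trans e p≡m+2)) v′₀ ,
  at-updateAt-true v p (suc m) (λ e → m≢1+n+m (suc m) {0} (trans e p≡m+2)) v′₁)))
... | no p≢m | no p≢m+1 | no p≢m+2 = inj₁ (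
  at-updateAt-true v p m (≢-sym p≢m) v′₀ ,
  at-updateAt-true v p (suc m) (≢-sym p≢m+1) v′₁ ,
  at-updateAt-true v p (suc (suc m)) (≢-sym p≢m+2) v′₂)

updateAt-threeHouses-right : (v : Vec Bool n) (p : Fin n) →
  at v (suc (toℕ p)) ≡ true → at v (suc (suc (toℕ p))) ≡ true → ThreeHouses (v [ p ]≔ true) (toℕ p)
updateAt-threeHouses-right (x ∷ v) zero    v₁ v₂ = refl , v₁ , v₂
updateAt-threeHouses-right (x ∷ v) (suc p) v₁ v₂ = updateAt-threeHouses-right v p v₁ v₂

updateAt-threeHouses-left : (v : Vec Bool (suc (suc n))) (p : Fin n) →
  at v (toℕ p) ≡ true → at v (suc (toℕ p)) ≡ true → ThreeHouses (v [ suc (suc p) ]≔ true) (toℕ p)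
updateAt-threeHouses-left (a ∷ b ∷ x ∷ v) zero    v₀ v₁ = v₀ , v₁ , refl
updateAt-threeHouses-left (a ∷ v)         (suc p) v₀ v₁ = updateAt-threeHouses-left v p v₀ v₁

goodWindow : Bool → Bool → Bool → Bool → Bool → Bool
goodWindow a b x d e = if x then not (b ∧ d) else (a ∧ b) ∨ (d ∧ e)

goodWindow-intro : ∀ a b x d e →
  (x ≡ true → b ≡ true → d ≡ true → ⊥) →
  (x ≡ false → (a ≡ true × b ≡ true) ⊎ (d ≡ true × e ≡ true)) →
  goodWindow a b x d e ≡ true
goodWindow-intro a true  true  true  e house _ = ⊥-elim (house refl refl refl)
goodWindow-intro a true  true  false e _     _ = refl
goodWindow-intro a false true  d     e _     _ = refl
goodWindow-intro a b     false d     e _     noHouse with noHouse refl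
... | inj₁ (refl , refl) = refl
... | inj₂ (refl , refl) = ∨-zeroʳ (a ∧ b)

goodWindow-house : ∀ a b x d e → goodWindow a b x d e ≡ true → x ≡ true → b ≡ true → d ≡ true → ⊥
goodWindow-house a .true .true .true e () refl refl refl

goodWindow-noHouse : ∀ a b x d e → goodWindow a b x d e ≡ true → x ≡ false →
  (a ≡ true × b ≡ true) ⊎ (d ≡ true × e ≡ true)
goodWindow-noHouse true true  .false d    e    _ refl = inj₁ (refl , refl)
goodWindow-noHouse a    b     .false true true _ refl = inj₂ (refl , refl)

window : Vec Bool n → ℕ → Bool
window v m = goodWindow (at v m) (at v (1 ℕ.+ m)) (at v (2 ℕ.+ m)) (at v (3 ℕ.+ m)) (at v (4 ℕ.+ m))

GoodWindows : Config n → Set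
GoodWindows {n} c = (p : Fin n) → window (false ∷ false ∷ c) (toℕ p) ≡ true

resistant⇒goodWindows : (c : Config n) → ResistantToAltruists c → GoodWindows c
resistant⇒goodWindows {n} c ((permissible , _) , resistant) p = goodWindow-intro _ _ _ _ _ house noHouse
  where
  m : ℕ
  m = toℕ p

  v : Config (2 ℕ.+ n)
  v = false ∷ false ∷ c

  moved : ∀ {l l′} → l ≡ l′ → at v l ≡ true → at v l′ ≡ true
  moved = subst (λ l → at v l ≡ true)

  house : at v (2 ℕ.+ m) ≡ true → at v (1 ℕ.+ m) ≡ true → at v (3 ℕ.+ m) ≡ true → ⊥
  house x b d = permissible p (threeHouses⇒blocked c p (b , x , d))

  noHouse : at v (2 ℕ.+ m) ≡ false →
    (at v m ≡ true × at v (1 ℕ.+ m) ≡ true) ⊎ (at v (3 ℕ.+ m) ≡ true × at v (4 ℕ.+ m) ≡ true)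
  noHouse x with resistant p (trans (lookup≡at c p) x)
  ... | q , q≢p , blocked
    with threeHouses-updateAt v (suc (suc p)) (suc (toℕ q)) (blocked⇒threeHouses (c [ p ]≔ true) q blocked)
  ... | inj₁ before = ⊥-elim (permissible q (threeHouses⇒blocked c q before))
  ... | inj₂ (inj₁ (p+2≡q+1 , d , e)) =
    inj₂ (moved (cong suc (sym p+2≡q+1)) d , moved (cong (λ l → suc (suc l)) (sym p+2≡q+1)) e)
  ... | inj₂ (inj₂ (inj₁ p+2≡q+2)) =
    ⊥-elim (q≢p (toℕ-injective (sym (suc-injective (suc-injective p+2≡q+2)))))
  ... | inj₂ (inj₂ (inj₂ (p+2≡q+3 , a , b))) =
    inj₁ (moved (sym m≡q+1) a , moved (cong suc (sym m≡q+1)) b)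
    where m≡q+1 = suc-injective (suc-injective p+2≡q+3)

goodWindows⇒resistant : (c : Config n) → GoodWindows c → ResistantToAltruists c
goodWindows⇒resistant {n} c good = (permissible , saturated) , resistant
  where
  v : Config (2 ℕ.+ n)
  v = false ∷ false ∷ c

  permissible : Permissible c
  permissible q blocked with blocked⇒threeHouses c q blocked
  ... | b , x , d = goodWindow-house _ _ _ _ _ (good q) x b d

  resistant : ∀ p → lookup c p ≡ false → ∃[ q ] q ≢ p × Blocked (c [ p ]≔ true) q
  resistant p c[p] with goodWindow-noHouse _ _ _ _ _ (good p) (trans (sym (lookup≡at c p)) c[p])
  ... | inj₂ (d , e) with at-lookup c (suc (toℕ p)) d
  ...   | q , q≡p+1 , _ =
    q , (λ q≡p → 1+n≢n (trans (sym q≡p+1) (cong toℕ q≡p))) ,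
    threeHouses⇒blocked (c [ p ]≔ true) q
      (subst (ThreeHouses (v [ suc (suc p) ]≔ true)) (cong suc (sym q≡p+1))
        (updateAt-threeHouses-right v (suc (suc p)) d e))
  resistant p c[p] | inj₁ (a , b) with at-lookup (false ∷ c) (toℕ p) b
  ...   | suc q , q+1≡p , _ =
    q , (λ q≡p → 1+n≢n (trans (cong (suc ∘ toℕ) (sym q≡p)) q+1≡p)) ,
    threeHouses⇒blocked (c [ p ]≔ true) q
      (subst (ThreeHouses (v [ suc (suc p) ]≔ true)) (sym q+1≡p)
        (updateAt-threeHouses-left v p a b))

  saturated : ∀ p → lookup c p ≡ false → ¬ Permissible (c [ p ]≔ true)
  saturated p c[p] permissible′ with resistant p c[p]
  ... | q , _ , blocked = permissible′ q blocked

resistant⇔goodWindows : (c : Config n) → ResistantToAltruists c ⇔ GoodWindows c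
resistant⇔goodWindows c = mk⇔ (resistant⇒goodWindows c) (goodWindows⇒resistant c)

-- Counting with an automaton

-- The state a b x d holds the last four lots read; the window of x is checked once the next lot is
-- read.
State : Set
State = Vec Bool 4

acceptsFrom : State → Vec Bool n → Bool
acceptsFrom (a ∷ b ∷ x ∷ d ∷ []) []      = goodWindow a b x d false ∧ goodWindow b x d false false
acceptsFrom (a ∷ b ∷ x ∷ d ∷ []) (e ∷ r) = goodWindow a b x d e ∧ acceptsFrom (b ∷ x ∷ d ∷ e ∷ []) r

accepts : Config n → Bool
accepts []          = true
accepts (x ∷ [])    = goodWindow false false x false false
accepts (x ∷ d ∷ r) = acceptsFrom (false ∷ false ∷ x ∷ d ∷ []) r

acceptsFrom⇔windows : (s : State) (r : Vec Bool n) →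
                      acceptsFrom s r ≡ true ⇔ ((p : Fin (2 ℕ.+ n)) → window (s ++ r) (toℕ p) ≡ true)
acceptsFrom⇔windows s r = mk⇔ (sound s r) (complete s r)
  where
  sound : (s : State) (r : Vec Bool n) → acceptsFrom s r ≡ true →
          (p : Fin (2 ℕ.+ n)) → window (s ++ r) (toℕ p) ≡ true
  sound (a ∷ b ∷ x ∷ d ∷ []) []      ok zero       = ∧-conicalˡ _ _ ok
  sound (a ∷ b ∷ x ∷ d ∷ []) []      ok (suc zero) = ∧-conicalʳ _ _ ok
  sound (a ∷ b ∷ x ∷ d ∷ []) (e ∷ r) ok            =
    ∀-cons (∧-conicalˡ _ _ ok) (sound (b ∷ x ∷ d ∷ e ∷ []) r (∧-conicalʳ _ _ ok))

  complete : (s : State) (r : Vec Bool n) →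
             ((p : Fin (2 ℕ.+ n)) → window (s ++ r) (toℕ p) ≡ true) → acceptsFrom s r ≡ true
  complete (a ∷ b ∷ x ∷ d ∷ []) []      ok = ∧-intro (ok zero) (ok (suc zero))
  complete (a ∷ b ∷ x ∷ d ∷ []) (e ∷ r) ok =
    ∧-intro (ok zero) (complete (b ∷ x ∷ d ∷ e ∷ []) r (ok ∘ suc))

accepts⇔goodWindows : (c : Config n) → accepts c ≡ true ⇔ GoodWindows c
accepts⇔goodWindows []          = mk⇔ (λ _ ()) (λ _ → refl)
accepts⇔goodWindows (x ∷ [])    = mk⇔ (λ { ok zero → ok }) (λ ok → ok zero)
accepts⇔goodWindows (x ∷ d ∷ r) = acceptsFrom⇔windows (false ∷ false ∷ x ∷ d ∷ []) r

does-resistant?≡accepts : (c : Config n) → does (resistant? c) ≡ accepts c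
does-resistant?≡accepts c = does-≡ (resistant? c) (accepts c)
  (from (accepts⇔goodWindows c) ∘ to (resistant⇔goodWindows c))
  (from (resistant⇔goodWindows c) ∘ to (accepts⇔goodWindows c))
  where open Equivalence

-- The size test comes first so that coefficients with k beyond the length evaluate to 0 even when
-- the predicate does not.
countSeries : (∀ {n} → Config n → Bool) → FPS
countSeries P k n = + length (filterᵇ (λ c → (occupied c ≡ᵇ k) ∧ P c) (allConfigs n))

JAseries≐countSeries-accepts : JAseries ≐ countSeries accepts
JAseries≐countSeries-accepts k n = cong (λ cs → + length cs) $ filter-cong _ _
  (λ c → trans (cong (_∧ (occupied c ≡ᵇ k)) (does-resistant?≡accepts c)) (∧-comm (accepts c) _))
  (allConfigs n)

countSeries-step : ∀ (P : ∀ {n} → Config n → Bool) →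
  dropColumn (countSeries P) ≐
  (countSeries (λ c → P (false ∷ c)) ⊕ shift 1 0 (countSeries (λ c → P (true ∷ c))))
countSeries-step P k n = begin
  + length (filterᵇ p (map (false ∷_) cs ++ᴸ map (true ∷_) cs))
    ≡⟨ cong +_ (trans (cong length (filter-++ (T? ∘ p) (map (false ∷_) cs) _))
                      (length-++ (filterᵇ p (map (false ∷_) cs)))) ⟩
  + length (filterᵇ p (map (false ∷_) cs)) + + length (filterᵇ p (map (true ∷_) cs))
    ≡⟨ cong₂ _+_ (cong +_ (length-filter-map (T? ∘ p) (false ∷_) cs)) (houseFirst k) ⟩
  countSeries (λ c → P (false ∷ c)) k n + shift 1 0 (countSeries (λ c → P (true ∷ c))) k n ∎
  where
  cs : List (Config n)
  cs = allConfigs n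

  p : Config (suc n) → Bool
  p c = (occupied c ≡ᵇ k) ∧ P c

  houseFirst : ∀ k → + length (filterᵇ (λ c → (occupied c ≡ᵇ k) ∧ P c) (map (true ∷_) cs)) ≡
                     shift 1 0 (countSeries (λ c → P (true ∷ c))) k n
  houseFirst zero    = cong +_
    (trans (length-filter-map _ (true ∷_) cs) (cong length (filterᵇ-none _ (λ _ → refl) cs)))
  houseFirst (suc k) = cong +_ (length-filter-map _ (true ∷_) cs)

countSeries-false : countSeries (λ _ → false) ≐ zeroSeries
countSeries-false k n =
  cong (λ cs → + length cs) (filterᵇ-none _ (λ c → ∧-zeroʳ (occupied c ≡ᵇ k)) (allConfigs n))

module CountAnnihilation (ts : Terms) where
  open Annihilation ts

  annihilates-∧ : ∀ {P : ∀ {n} → Config n → Bool} w →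
    AnnihilatesColumn (countSeries P) n → AnnihilatesColumn (countSeries (λ c → w ∧ P c)) n
  annihilates-∧ true  P↯ = P↯
  annihilates-∧ false _  = annihilates-cong (λ k n → sym (countSeries-false k n)) annihilates-zero

  annihilates-countSeries : ∀ {P : ∀ {n} → Config n → Bool} → All (λ t → yExponent t ≤ n) ts →
    AnnihilatesColumn (countSeries (λ c → P (false ∷ c))) n →
    AnnihilatesColumn (countSeries (λ c → P (true ∷ c))) n →
    AnnihilatesColumn (countSeries P) (suc n)
  annihilates-countSeries {P = P} ts≤n noHouse↯ house↯ = annihilates-dropColumn ts≤n $
    annihilates-cong (λ k n → sym (countSeries-step P k n)) (annihilates-⊕ noHouse↯ (annihilates-shiftˣ house↯))

allConfigs-complete : (c : Config n) → c ∈ allConfigs n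
allConfigs-complete []          = here refl
allConfigs-complete (false ∷ c) = ∈-++⁺ˡ (∈-map⁺ (false ∷_) (allConfigs-complete c))
allConfigs-complete (true ∷ c)  = ∈-++⁺ʳ _ (∈-map⁺ (true ∷_) (allConfigs-complete c))

denominatorTerms : Terms
denominatorTerms = (+ 1 , 0 , 0) ∷ (- + 1 , 2 , 3) ∷ (- + 1 , 2 , 4) ∷ (- + 1 , 3 , 5) ∷ []

denominator-yExponents : 5 ≤ n → All (λ t → yExponent t ≤ n) denominatorTerms
denominator-yExponents 5≤n =
  All.map (λ j≤5 → ≤-trans j≤5 5≤n) (from-yes (all? (λ t → yExponent t ≤? 5) denominatorTerms))

timesDenominator : FPS → FPS
timesDenominator = shiftCombination denominatorTerms

open Annihilation denominatorTerms
open CountAnnihilation denominatorTerms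

acceptsFrom-annihilated₅ : (s : State) → AnnihilatesColumn (countSeries (acceptsFrom s)) 5
acceptsFrom-annihilated₅ s = annihilates $
  ℕ-split 6 (λ k k<6 → All.lookup (All.lookup checked (allConfigs-complete s)) (∈-upTo⁺ k<6)) (λ _ → refl)
  where
  checked : All (λ s → All (λ k → timesDenominator (countSeries (acceptsFrom s)) k 5 ≡ + 0) (upTo 6)) (allConfigs 4)
  checked = from-yes $
    all? (λ s → all? (λ k → timesDenominator (countSeries (acceptsFrom s)) k 5 ℤ.≟ + 0) (upTo 6)) (allConfigs 4)

acceptsFrom-annihilated : ∀ m (s : State) → AnnihilatesColumn (countSeries (acceptsFrom s)) (5 ℕ.+ m)
acceptsFrom-annihilated zero    s                    = acceptsFrom-annihilated₅ s
acceptsFrom-annihilated (suc m) (a ∷ b ∷ x ∷ d ∷ []) =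
  annihilates-countSeries (denominator-yExponents (m≤m+n 5 m))
    (annihilates-∧ (goodWindow a b x d false) (acceptsFrom-annihilated m (b ∷ x ∷ d ∷ false ∷ [])))
    (annihilates-∧ (goodWindow a b x d true)  (acceptsFrom-annihilated m (b ∷ x ∷ d ∷ true ∷ [])))

accepts-annihilated : ∀ m → AnnihilatesColumn (countSeries accepts) (7 ℕ.+ m)
accepts-annihilated m =
  annihilates-countSeries (denominator-yExponents (m≤m+n 5 (suc m))) (afterFirst false) (afterFirst true)
  where
  afterFirst : ∀ x → AnnihilatesColumn (countSeries (λ c → accepts (x ∷ c))) (6 ℕ.+ m)
  afterFirst x = annihilates-countSeries (denominator-yExponents (m≤m+n 5 m))
    (acceptsFrom-annihilated m (false ∷ false ∷ x ∷ false ∷ []))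
    (acceptsFrom-annihilated m (false ∷ false ∷ x ∷ true ∷ []))

numerator-vanishes : ∀ k m → numerator k (5 ℕ.+ m) ≡ + 0
numerator-vanishes 0                          m = refl
numerator-vanishes 1                          m = refl
numerator-vanishes 2                          m = refl
numerator-vanishes 3                          m = refl
numerator-vanishes (suc (suc (suc (suc k)))) m = refl

initial-column : ∀ n → n < 7 → ∀ k → timesDenominator (countSeries accepts) k n ≡ numerator k n
initial-column n n<7 = ℕ-split 7 (λ k k<7 → All.lookup (All.lookup checked (∈-upTo⁺ n<7)) (∈-upTo⁺ k<7))
                                  (All.lookup beyondLength (∈-upTo⁺ n<7))
  where
  checked : All (λ n → All (λ k → timesDenominator (countSeries accepts) k n ≡ numerator k n) (upTo 7)) (upTo 7)
  checked = from-yes $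
    all? (λ n → all? (λ k → timesDenominator (countSeries accepts) k n ℤ.≟ numerator k n) (upTo 7)) (upTo 7)

  beyondLength : All (λ n → ∀ k → timesDenominator (countSeries accepts) (7 ℕ.+ k) n ≡
                                  numerator (7 ℕ.+ k) n)
                     (upTo 7)
  beyondLength =
    (λ _ → refl) ∷ (λ _ → refl) ∷ (λ _ → refl) ∷ (λ _ → refl) ∷ (λ _ → refl) ∷ (λ _ → refl) ∷ (λ _ → refl) ∷ []

countSeries-accepts-columns : ∀ n k → timesDenominator (countSeries accepts) k n ≡ numerator k n
countSeries-accepts-columns = ℕ-split 7 initial-column λ m k →
  trans (AnnihilatesColumn.vanishes (accepts-annihilated m) k) (sym (numerator-vanishes k (2 ℕ.+ m)))

factor₂Terms : Terms
factor₂Terms = (+ 1 , 0 , 0) ∷ (+ 1 , 1 , 2) ∷ []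

denominator-factorises : ∀ k n → denominator k n ≡ shiftCombination factor₂Terms factor₁ k n
denominator-factorises 0 0                                      = refl
denominator-factorises 0 (suc n)                                = refl
denominator-factorises 1 0                                      = refl
denominator-factorises 1 1                                      = refl
denominator-factorises 1 2                                      = refl
denominator-factorises 1 (suc (suc (suc n)))                    = refl
denominator-factorises 2 0                                      = refl
denominator-factorises 2 1                                      = refl
denominator-factorises 2 2                                      = refl
denominator-factorises 2 3                                      = refl
denominator-factorises 2 4                                      = refl
denominator-factorises 2 (suc (suc (suc (suc (suc n)))))        = refl
denominator-factorises 3 0                                      = refl
denominator-factorises 3 1                                      = refl
denominator-factorises 3 2                                      = refl
denominator-factorises 3 3                                      = refl
denominator-factorises 3 4                                      = refl
denominator-factorises 3 5                                      = refl
denominator-factorises 3 (suc (suc (suc (suc (suc (suc n))))))  = refl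
denominator-factorises (suc (suc (suc (suc k)))) 0              = refl
denominator-factorises (suc (suc (suc (suc k)))) 1              = refl
denominator-factorises (suc (suc (suc (suc k)))) (suc (suc n))  = refl

mainTheorem3 : ((JAseries ⊛ denominator) ≐ numerator) × (denominator ≐ (factor₁ ⊛ factor₂))
mainTheorem3 = generatingFunction , factorisation
  where
  generatingFunction : (JAseries ⊛ denominator) ≐ numerator
  generatingFunction k n = begin
    (JAseries ⊛ denominator) k n                ≡⟨ ⊛-poly JAseries denominatorTerms k n ⟩
    timesDenominator JAseries k n               ≡⟨ shiftCombination-cong denominatorTerms JAseries≐countSeries-accepts k n ⟩
    timesDenominator (countSeries accepts) k n  ≡⟨ countSeries-accepts-columns n k ⟩
    numerator k n                               ∎

  factorisation : denominator ≐ (factor₁ ⊛ factor₂)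
  factorisation k n = trans (denominator-factorises k n) (sym (⊛-poly factor₁ factor₂Terms k n))
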